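{- Let $q$ be a prime power, $n\ge1$, and let $F\in\mathbb{F}_{q^n}[x]$ be non-constant with $V_F\subseteq\mathbb{F}_q$. Then the following are equivalent: (1) $F$ is a minimal value set polynomial over $\mathbb{F}_{q^n}$ with $V_F=\mathbb{F}_q$; (2) $F^q-F=(x^{q^n}-x)F'$; (3) $q^{n-1}\le\deg F\le (q^n-1)/(q-1)$; (4) $0<\deg F\le (q^n-1)/(q-1)$.
   Context: Here $V_F=\{F(a):a\in\mathbb{F}_{q^n}\}$, and $F$ is a minimal value set polynomial over $\mathbb{F}_{q^n}$ if $|V_F|=\lfloor (q^n-1)/\deg F\rfloor+1$. The case $q=2$ is allowed. -}

module Defs where

open import Data.Nat as ℕ using (ℕ; zero; suc; _^_; _≤_; _∸_)
open import Data.Nat.DivMod using (_/_)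
open import Data.Nat.Primality using (Prime)
open import Data.Fin using (Fin)
open import Data.Fin.Properties using (any?)
open import Data.Bool using (Bool; true; false; if_then_else_)
open import Data.List using (List; []; _∷_; replicate; _++_)
open import Data.Product using (Σ; ∃; ∃-syntax; _×_; _,_)
open import Relation.Nullary using (¬_; Dec; yes; no)
open import Relation.Nullary.Decidable using (⌊_⌋)
open import Relation.Binary.PropositionalEquality using (_≡_; _≢_)
open import Algebra.Structures using (IsCommutativeRing)
open import Function.Bundles using (_↔_; Inverse)
open import Level using (0ℓ)

record FiniteField : Set₁ where
  infixl 6 _+_
  infixl 7 _*_
  field
    Carrier : Set
    _+_ _*_ : Carrier → Carrier → Carrier
    -_ : Carrier → Carrier
    0# 1# : Carrier
    isCommutativeRing : IsCommutativeRing _≡_ _+_ _*_ -_ 0# 1#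
    0≢1 : 0# ≢ 1#
    inverse : ∀ x → x ≢ 0# → ∃[ y ] (x * y ≡ 1#)
    _≟_ : (x y : Carrier) → Dec (x ≡ y)
    size : ℕ
    enum : Fin size ↔ Carrier

IsPrimePower : ℕ → Set
IsPrimePower q = Σ ℕ λ p → Σ ℕ λ k → Prime p × 1 ≤ k × q ≡ p ^ k

record IsFieldEmbedding (E K : FiniteField) (ι : FiniteField.Carrier E → FiniteField.Carrier K) : Set where
  private
    module E = FiniteField E
    module K = FiniteField K
  field
    +-hom : ∀ a b → ι (a E.+ b) ≡ ι a K.+ ι b
    *-hom : ∀ a b → ι (a E.* b) ≡ ι a K.* ι b
    1-hom : ι E.1# ≡ K.1#
    injective : ∀ a b → ι a ≡ ι b → a ≡ b

-- floor division, with the convention m / 0 = 0 (only used with nonzero divisor)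
floorDiv : ℕ → ℕ → ℕ
floorDiv m zero = 0
floorDiv m (suc d) = m / suc d

countFin : (m : ℕ) → (Fin m → Bool) → ℕ
countFin zero f = 0
countFin (suc m) f = (if f Fin.zero then 1 else 0) ℕ.+ countFin m (λ i → f (Fin.suc i))

-- Univariate polynomials over K as coefficient lists, lowest degree first.
module Poly (K : FiniteField) where
  open FiniteField K

  Pol : Set
  Pol = List Carrier

  coeff : Pol → ℕ → Carrier
  coeff [] _ = 0#
  coeff (a ∷ p) zero = a
  coeff (a ∷ p) (suc i) = coeff p i

  _≐_ : Pol → Pol → Set
  p ≐ r = ∀ i → coeff p i ≡ coeff r i

  isZero : Pol → Bool
  isZero [] = true
  isZero (a ∷ p) = if ⌊ a ≟ 0# ⌋ then isZero p else false

  -- degree (index of the highest nonzero coefficient; deg 0 = 0)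
  deg : Pol → ℕ
  deg [] = 0
  deg (a ∷ p) = if isZero p then 0 else suc (deg p)

  eval : Pol → Carrier → Carrier
  eval [] x = 0#
  eval (a ∷ p) x = a + x * eval p x

  add : Pol → Pol → Pol
  add [] r = r
  add (a ∷ p) [] = a ∷ p
  add (a ∷ p) (b ∷ r) = (a + b) ∷ add p r

  neg : Pol → Pol
  neg [] = []
  neg (a ∷ p) = (- a) ∷ neg p

  sub : Pol → Pol → Pol
  sub p r = add p (neg r)

  scale : Carrier → Pol → Pol
  scale c [] = []
  scale c (a ∷ p) = (c * a) ∷ scale c p

  mul : Pol → Pol → Pol
  mul [] r = []
  mul (a ∷ p) r = add (scale a r) (0# ∷ mul p r)

  pow : Pol → ℕ → Pol
  pow p zero = 1# ∷ []
  pow p (suc k) = mul p (pow p k)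

  natMul : ℕ → Carrier → Carrier
  natMul zero a = 0#
  natMul (suc n) a = a + natMul n a

  derivAux : ℕ → Pol → Pol
  derivAux i [] = []
  derivAux i (a ∷ p) = natMul i a ∷ derivAux (suc i) p

  deriv : Pol → Pol
  deriv [] = []
  deriv (a ∷ p) = derivAux 1 p

  X : Pol
  X = 0# ∷ 1# ∷ []

  monomial : ℕ → Pol
  monomial m = replicate m 0# ++ (1# ∷ [])

  valueSetSize : Pol → ℕ
  valueSetSize F = countFin size (λ i →
    ⌊ any? (λ j → eval F (Inverse.to enum j) ≟ Inverse.to enum i) ⌋)

  IsMVSP : Pol → Set
  IsMVSP F = valueSetSize F ≡ suc (floorDiv (size ∸ 1) (deg F))

{-# OPTIONS --safe #-}

-- Write q = |F_q|, Q = q^n and d = deg F. A non-constant F takes each value at most d times, and its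
-- fibres over the q elements of F_q cover F_{q^n}; hence Q ≤ q d, and even Q + d ≤ q d if a value of
-- F_q is missed. Everything is therefore governed by q d < Q + d, the ∸-free form of (q − 1) d ≤ Q − 1.
-- It forces V_F = F_q, and then |V_F| = q = ⌊(Q − 1)/d⌋ + 1 is exactly minimality. It is also
-- equivalent to F^q − F = (x^Q − x) F′: the difference Δ of the two sides has a double root at every
-- point of F_{q^n} (F(a)^q = F(a), a^Q = a, and q = Q = 0 there), so Δ = 0 as soon as deg Δ < 2Q,
-- which the bound guarantees; conversely, if q d ≥ Q + d then the leading term of F^q survives in Δ.

module Submission where

open import Defs
open import Level using (0ℓ)
open import Algebra.Bundles using (CommutativeRing; CommutativeMonoid)
import Algebra.Properties.Ring as RingProperties
import Algebra.Properties.CommutativeMonoid.Sum as CommutativeMonoidSum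
import Algebra.Solver.Ring.NaturalCoefficients.Default as SemiringSolver
open import Data.Nat as ℕ using (ℕ; zero; suc; z≤n; s≤s)
import Data.Nat.Properties as ℕ
open import Data.Bool using (true; false)
open import Data.Fin using (Fin; zero; suc; punchIn)
open import Data.Fin.Properties using (punchInᵢ≢i; any?)
open import Data.List using (List; []; _∷_; length; map; filter; allFin)
import Data.List.Properties as List
open import Data.List.Relation.Unary.All as All using (All; []; _∷_)
import Data.List.Relation.Unary.All.Properties as All
open import Data.List.Relation.Unary.AllPairs using ([]; _∷_)
open import Data.List.Relation.Unary.Unique.Propositional using (Unique)
import Data.List.Relation.Unary.Unique.Propositional.Properties as Unique
open import Data.Product using (∃-syntax; _×_; _,_; proj₁; proj₂)
open import Data.Empty using (⊥-elim)
open import Function using (_∘_; Inverse; Injection; _↔_; mk↔ₛ′; _⇔_; mk⇔; Equivalence)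
open import Function.Properties.Inverse using (↔⇒↣)
open import Function.Construct.Composition using (_↔-∘_)
open import Function.Construct.Symmetry using (↔-sym)
open import Function.Properties.Equivalence using () renaming (trans to ⇔-trans; sym to ⇔-sym)
open import Relation.Nullary using (¬_; Dec; yes; no)
open import Relation.Nullary.Decidable using (⌊_⌋)
open import Relation.Nullary.Negation using (contradiction)
open import Relation.Unary using (Pred; Decidable)
open import Relation.Binary.PropositionalEquality

module FieldLemmas (L : FiniteField) where
  open FiniteField L public

  commutativeRing : CommutativeRing 0ℓ 0ℓ
  commutativeRing = record { isCommutativeRing = isCommutativeRing }

  open CommutativeRing commutativeRing public
    using ( ring; _-_; +-comm; +-assoc; *-comm; *-assoc; +-identityˡ; +-identityʳ
          ; *-identityˡ; *-identityʳ; zeroˡ; zeroʳ; distribʳ; -‿inverseʳ; -‿inverseˡ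
          ; +-commutativeMonoid; *-commutativeMonoid)
  open RingProperties ring public
    using (-0#≈0#; -1*x≈-x; -‿distribˡ-*; -‿distribʳ-*; -‿+-comm; +-cancelʳ; +-cancelˡ; x∙y⁻¹≈ε⇒x≈y)
  open import Algebra.Properties.Semiring.Exp (CommutativeRing.semiring commutativeRing) public
    using (_^_)
  open SemiringSolver (CommutativeRing.commutativeSemiring commutativeRing) public
    using (solve; _:=_; _:+_; _:*_; con)

  x*y≡0⇒y≡0 : ∀ {x y} → x ≢ 0# → x * y ≡ 0# → y ≡ 0#
  x*y≡0⇒y≡0 {x} {y} x≢0 xy≡0 with inverse x x≢0
  ... | x⁻¹ , xx⁻¹≡1 = begin
    y               ≡⟨ *-identityˡ y ⟨
    1# * y          ≡⟨ cong (_* y) xx⁻¹≡1 ⟨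
    x * x⁻¹ * y     ≡⟨ solve 3 (λ x x⁻¹ y → x :* x⁻¹ :* y := x⁻¹ :* (x :* y)) refl x x⁻¹ y ⟩
    x⁻¹ * (x * y)   ≡⟨ cong (x⁻¹ *_) xy≡0 ⟩
    x⁻¹ * 0#        ≡⟨ zeroʳ x⁻¹ ⟩
    0#              ∎
    where open ≡-Reasoning

  *-difference : ∀ {a b y} → a * y ≡ b * y → (a - b) * y ≡ 0#
  *-difference {a} {b} {y} ay≡by = begin
    (a - b) * y        ≡⟨ distribʳ y a (- b) ⟩
    a * y + - b * y    ≡⟨ cong₂ _+_ (sym ay≡by) (-‿distribˡ-* b y) ⟨
    b * y + - (b * y)  ≡⟨ -‿inverseʳ (b * y) ⟩
    0#                 ∎
    where open ≡-Reasoning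

  *-cancelʳ-≢ : ∀ {a b y} → a ≢ b → a * y ≡ b * y → y ≡ 0#
  *-cancelʳ-≢ {a} {b} a≢b ay≡by =
    x*y≡0⇒y≡0 (λ a-b≡0 → a≢b (x∙y⁻¹≈ε⇒x≈y a b a-b≡0)) (*-difference ay≡by)

  *-cancelʳ-≢0 : ∀ {a b y} → y ≢ 0# → a * y ≡ b * y → a ≡ b
  *-cancelʳ-≢0 {a} {b} {y} y≢0 ay≡by =
    x∙y⁻¹≈ε⇒x≈y a b (x*y≡0⇒y≡0 y≢0 (trans (*-comm y (a - b)) (*-difference ay≡by)))

  -- Hypotheses in the subtraction-free shape produced by eval-quotient.
  shared-root : ∀ {a b x x′ y} → a ≢ b → x ≡ 0# → x′ ≡ 0# → x + a * y ≡ x′ + b * y → y ≡ 0#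
  shared-root {a} {b} {x} {x′} {y} a≢b x≡0 x′≡0 eq = *-cancelʳ-≢ a≢b (begin
    a * y        ≡⟨ +-identityˡ _ ⟨
    0# + a * y   ≡⟨ cong (λ u → u + a * y) x≡0 ⟨
    x + a * y    ≡⟨ eq ⟩
    x′ + b * y   ≡⟨ cong (λ u → u + b * y) x′≡0 ⟩
    0# + b * y   ≡⟨ +-identityˡ _ ⟩
    b * y        ∎)
    where open ≡-Reasoning

  ^-≢0 : ∀ {x} k → x ≢ 0# → x ^ k ≢ 0#
  ^-≢0 zero    x≢0 1≡0 = 0≢1 (sym 1≡0)
  ^-≢0 (suc k) x≢0 xxᵏ≡0 = ^-≢0 k x≢0 (x*y≡0⇒y≡0 x≢0 xxᵏ≡0)


module PolynomialLemmas (K : FiniteField) where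
  open FieldLemmas K public
  open Poly K public

  natMul-0# : ∀ k → natMul k 0# ≡ 0#
  natMul-0# zero    = refl
  natMul-0# (suc k) = trans (+-identityˡ _) (natMul-0# k)

  eval-add : ∀ p r b → eval (add p r) b ≡ eval p b + eval r b
  eval-add []      r       b = sym (+-identityˡ _)
  eval-add (a ∷ p) []      b = sym (+-identityʳ _)
  eval-add (a ∷ p) (c ∷ r) b = begin
    (a + c) + b * eval (add p r) b
      ≡⟨ cong (λ u → (a + c) + b * u) (eval-add p r b) ⟩
    (a + c) + b * (eval p b + eval r b)
      ≡⟨ solve 5 (λ a c b P R → (a :+ c) :+ b :* (P :+ R) := (a :+ b :* P) :+ (c :+ b :* R)) refl a c b (eval p b) (eval r b) ⟩
    (a + b * eval p b) + (c + b * eval r b) ∎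
    where open ≡-Reasoning

  eval-neg : ∀ p b → eval (neg p) b ≡ - eval p b
  eval-neg []      b = sym -0#≈0#
  eval-neg (a ∷ p) b = begin
    - a + b * eval (neg p) b    ≡⟨ cong (λ u → - a + b * u) (eval-neg p b) ⟩
    - a + b * - eval p b        ≡⟨ cong (- a +_) (-‿distribʳ-* b _) ⟨
    - a + - (b * eval p b)      ≡⟨ -‿+-comm a _ ⟩
    - (a + b * eval p b)        ∎
    where open ≡-Reasoning

  eval-sub : ∀ p r b → eval (sub p r) b ≡ eval p b - eval r b
  eval-sub p r b = trans (eval-add p (neg r) b) (cong (eval p b +_) (eval-neg r b))

  eval-scale : ∀ c p b → eval (scale c p) b ≡ c * eval p b
  eval-scale c []      b = sym (zeroʳ c)
  eval-scale c (a ∷ p) b = begin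
    c * a + b * eval (scale c p) b
      ≡⟨ cong (λ u → c * a + b * u) (eval-scale c p b) ⟩
    c * a + b * (c * eval p b)
      ≡⟨ solve 4 (λ c a b P → c :* a :+ b :* (c :* P) := c :* (a :+ b :* P)) refl c a b (eval p b) ⟩
    c * (a + b * eval p b) ∎
    where open ≡-Reasoning

  eval-mul : ∀ p r b → eval (mul p r) b ≡ eval p b * eval r b
  eval-mul []      r b = sym (zeroˡ _)
  eval-mul (a ∷ p) r b = begin
    eval (add (scale a r) (0# ∷ mul p r)) b
      ≡⟨ eval-add (scale a r) (0# ∷ mul p r) b ⟩
    eval (scale a r) b + (0# + b * eval (mul p r) b)
      ≡⟨ cong₂ (λ u v → u + (0# + b * v)) (eval-scale a r b) (eval-mul p r b) ⟩
    a * eval r b + (0# + b * (eval p b * eval r b))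
      ≡⟨ solve 4 (λ a R b P → a :* R :+ (con 0 :+ b :* (P :* R)) := (a :+ b :* P) :* R) refl a (eval r b) b (eval p b) ⟩
    (a + b * eval p b) * eval r b ∎
    where open ≡-Reasoning

  eval-pow : ∀ p k b → eval (pow p k) b ≡ eval p b ^ k
  eval-pow p zero    b = trans (cong (1# +_) (zeroʳ b)) (+-identityʳ 1#)
  eval-pow p (suc k) b = trans (eval-mul p (pow p k) b) (cong (eval p b *_) (eval-pow p k b))

  eval-monomial : ∀ m b → eval (monomial m) b ≡ b ^ m
  eval-monomial zero    b = trans (cong (1# +_) (zeroʳ b)) (+-identityʳ 1#)
  eval-monomial (suc m) b = trans (+-identityˡ _) (cong (b *_) (eval-monomial m b))

  eval-X : ∀ b → eval X b ≡ b
  eval-X b = solve 1 (λ b → con 0 :+ b :* (con 1 :+ b :* con 0) := b) refl b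

  eval-derivAux-suc : ∀ i p b → eval (derivAux (suc i) p) b ≡ eval p b + eval (derivAux i p) b
  eval-derivAux-suc i []      b = sym (+-identityˡ 0#)
  eval-derivAux-suc i (a ∷ p) b = begin
    (a + natMul i a) + b * eval (derivAux (suc (suc i)) p) b
      ≡⟨ cong (λ u → (a + natMul i a) + b * u) (eval-derivAux-suc (suc i) p b) ⟩
    (a + natMul i a) + b * (eval p b + eval (derivAux (suc i) p) b)
      ≡⟨ solve 5 (λ a n b P D → (a :+ n) :+ b :* (P :+ D) := (a :+ b :* P) :+ (n :+ b :* D)) refl a (natMul i a) b (eval p b) (eval (derivAux (suc i) p) b) ⟩
    (a + b * eval p b) + (natMul i a + b * eval (derivAux (suc i) p) b) ∎
    where open ≡-Reasoning

  eval-deriv-∷ : ∀ c p b → eval (deriv (c ∷ p)) b ≡ eval p b + b * eval (deriv p) b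
  eval-deriv-∷ c p b = trans (eval-derivAux-suc 0 p b) (cong (eval p b +_) (derivAux-0 p))
    where
    derivAux-0 : ∀ p → eval (derivAux 0 p) b ≡ b * eval (deriv p) b
    derivAux-0 []      = sym (zeroʳ b)
    derivAux-0 (a ∷ p) = +-identityˡ _

  eval-deriv-add : ∀ p r b → eval (deriv (add p r)) b ≡ eval (deriv p) b + eval (deriv r) b
  eval-deriv-add []      r       b = sym (+-identityˡ _)
  eval-deriv-add (a ∷ p) []      b = sym (+-identityʳ _)
  eval-deriv-add (a ∷ p) (c ∷ r) b = begin
    eval (deriv ((a + c) ∷ add p r)) b
      ≡⟨ eval-deriv-∷ (a + c) (add p r) b ⟩
    eval (add p r) b + b * eval (deriv (add p r)) b
      ≡⟨ cong₂ (λ u v → u + b * v) (eval-add p r b) (eval-deriv-add p r b) ⟩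
    (P + R) + b * (P′ + R′)
      ≡⟨ solve 5 (λ P R b P′ R′ → (P :+ R) :+ b :* (P′ :+ R′) := (P :+ b :* P′) :+ (R :+ b :* R′)) refl P R b P′ R′ ⟩
    (P + b * P′) + (R + b * R′)
      ≡⟨ cong₂ _+_ (eval-deriv-∷ a p b) (eval-deriv-∷ c r b) ⟨
    eval (deriv (a ∷ p)) b + eval (deriv (c ∷ r)) b ∎
    where
    open ≡-Reasoning
    P R P′ R′ : Carrier
    P = eval p b; R = eval r b; P′ = eval (deriv p) b; R′ = eval (deriv r) b

  eval-deriv-neg : ∀ p b → eval (deriv (neg p)) b ≡ - eval (deriv p) b
  eval-deriv-neg []      b = sym -0#≈0#
  eval-deriv-neg (a ∷ p) b = begin
    eval (deriv (- a ∷ neg p)) b                        ≡⟨ eval-deriv-∷ (- a) (neg p) b ⟩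
    eval (neg p) b + b * eval (deriv (neg p)) b         ≡⟨ cong₂ (λ u v → u + b * v) (eval-neg p b) (eval-deriv-neg p b) ⟩
    - eval p b + b * - eval (deriv p) b                 ≡⟨ cong (- eval p b +_) (-‿distribʳ-* b _) ⟨
    - eval p b + - (b * eval (deriv p) b)               ≡⟨ -‿+-comm _ _ ⟩
    - (eval p b + b * eval (deriv p) b)                 ≡⟨ cong -_ (eval-deriv-∷ a p b) ⟨
    - eval (deriv (a ∷ p)) b                            ∎
    where open ≡-Reasoning

  eval-deriv-sub : ∀ p r b → eval (deriv (sub p r)) b ≡ eval (deriv p) b - eval (deriv r) b
  eval-deriv-sub p r b = trans (eval-deriv-add p (neg r) b) (cong (eval (deriv p) b +_) (eval-deriv-neg r b))

  eval-deriv-scale : ∀ c p b → eval (deriv (scale c p)) b ≡ c * eval (deriv p) b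
  eval-deriv-scale c []      b = sym (zeroʳ c)
  eval-deriv-scale c (a ∷ p) b = begin
    eval (deriv (c * a ∷ scale c p)) b
      ≡⟨ eval-deriv-∷ (c * a) (scale c p) b ⟩
    eval (scale c p) b + b * eval (deriv (scale c p)) b
      ≡⟨ cong₂ (λ u v → u + b * v) (eval-scale c p b) (eval-deriv-scale c p b) ⟩
    c * eval p b + b * (c * eval (deriv p) b)
      ≡⟨ solve 4 (λ c P b P′ → c :* P :+ b :* (c :* P′) := c :* (P :+ b :* P′)) refl c (eval p b) b (eval (deriv p) b) ⟩
    c * (eval p b + b * eval (deriv p) b)
      ≡⟨ cong (c *_) (eval-deriv-∷ a p b) ⟨
    c * eval (deriv (a ∷ p)) b ∎
    where open ≡-Reasoning

  eval-deriv-mul : ∀ p r b → eval (deriv (mul p r)) b ≡ eval (deriv p) b * eval r b + eval p b * eval (deriv r) b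
  eval-deriv-mul []      r b = sym (trans (cong (_+ 0# * eval (deriv r) b) (zeroˡ _)) (trans (+-identityˡ _) (zeroˡ _)))
  eval-deriv-mul (a ∷ p) r b = begin
    eval (deriv (add (scale a r) (0# ∷ mul p r))) b
      ≡⟨ eval-deriv-add (scale a r) (0# ∷ mul p r) b ⟩
    eval (deriv (scale a r)) b + eval (deriv (0# ∷ mul p r)) b
      ≡⟨ cong₂ _+_ (eval-deriv-scale a r b) (eval-deriv-∷ 0# (mul p r) b) ⟩
    a * R′ + (eval (mul p r) b + b * eval (deriv (mul p r)) b)
      ≡⟨ cong₂ (λ u v → a * R′ + (u + b * v)) (eval-mul p r b) (eval-deriv-mul p r b) ⟩
    a * R′ + (P * R + b * (P′ * R + P * R′))
      ≡⟨ solve 6 (λ a R′ P R b P′ → a :* R′ :+ (P :* R :+ b :* (P′ :* R :+ P :* R′)) := (P :+ b :* P′) :* R :+ (a :+ b :* P) :* R′) refl a R′ P R b P′ ⟩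
    (P + b * P′) * R + (a + b * P) * R′
      ≡⟨ cong (λ u → u * R + (a + b * P) * R′) (eval-deriv-∷ a p b) ⟨
    eval (deriv (a ∷ p)) b * R + eval (a ∷ p) b * R′ ∎
    where
    open ≡-Reasoning
    P R P′ R′ : Carrier
    P = eval p b; R = eval r b; P′ = eval (deriv p) b; R′ = eval (deriv r) b

  eval-deriv-pow : ∀ p k b → eval (deriv (pow p k)) b ≡ natMul k 1# * (eval p b ^ (k ℕ.∸ 1) * eval (deriv p) b)
  eval-deriv-pow p zero          b = sym (zeroˡ _)
  eval-deriv-pow p (suc zero)    b = begin
    eval (deriv (mul p (pow p 0))) b
      ≡⟨ eval-deriv-mul p (pow p 0) b ⟩
    P′ * eval (pow p 0) b + P * eval (deriv (pow p 0)) b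
      ≡⟨ cong₂ (λ u v → P′ * u + P * v) (eval-pow p 0 b) (eval-deriv-pow p 0 b) ⟩
    P′ * 1# + P * (0# * (1# * P′))
      ≡⟨ solve 2 (λ P′ P → P′ :* con 1 :+ P :* (con 0 :* (con 1 :* P′)) := (con 1 :+ con 0) :* (con 1 :* P′)) refl P′ P ⟩
    (1# + 0#) * (1# * P′) ∎
    where
    open ≡-Reasoning
    P P′ : Carrier
    P = eval p b; P′ = eval (deriv p) b
  eval-deriv-pow p (suc (suc k)) b = begin
    eval (deriv (mul p (pow p (suc k)))) b
      ≡⟨ eval-deriv-mul p (pow p (suc k)) b ⟩
    P′ * eval (pow p (suc k)) b + P * eval (deriv (pow p (suc k))) b
      ≡⟨ cong₂ (λ u v → P′ * u + P * v) (eval-pow p (suc k) b) (eval-deriv-pow p (suc k) b) ⟩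
    P′ * (P * P ^ k) + P * (n * (P ^ k * P′))
      ≡⟨ solve 4 (λ P′ P Pᵏ n → P′ :* (P :* Pᵏ) :+ P :* (n :* (Pᵏ :* P′)) := (con 1 :+ n) :* ((P :* Pᵏ) :* P′)) refl P′ P (P ^ k) n ⟩
    (1# + n) * ((P * P ^ k) * P′) ∎
    where
    open ≡-Reasoning
    P P′ n : Carrier
    P = eval p b; P′ = eval (deriv p) b; n = natMul (suc k) 1#

  eval-deriv-monomial : ∀ m b → eval (deriv (monomial m)) b ≡ natMul m 1# * b ^ (m ℕ.∸ 1)
  eval-deriv-monomial zero          b = sym (zeroˡ _)
  eval-deriv-monomial (suc zero)    b = begin
    eval (deriv (0# ∷ monomial 0)) b
      ≡⟨ eval-deriv-∷ 0# (monomial 0) b ⟩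
    eval (monomial 0) b + b * eval (deriv (monomial 0)) b
      ≡⟨ cong₂ (λ u v → u + b * v) (eval-monomial 0 b) (eval-deriv-monomial 0 b) ⟩
    1# + b * (0# * 1#)
      ≡⟨ solve 1 (λ b → con 1 :+ b :* (con 0 :* con 1) := (con 1 :+ con 0) :* con 1) refl b ⟩
    (1# + 0#) * 1# ∎
    where open ≡-Reasoning
  eval-deriv-monomial (suc (suc m)) b = begin
    eval (deriv (0# ∷ monomial (suc m))) b
      ≡⟨ eval-deriv-∷ 0# (monomial (suc m)) b ⟩
    eval (monomial (suc m)) b + b * eval (deriv (monomial (suc m))) b
      ≡⟨ cong₂ (λ u v → u + b * v) (eval-monomial (suc m) b) (eval-deriv-monomial (suc m) b) ⟩
    b * b ^ m + b * (n * b ^ m)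
      ≡⟨ solve 3 (λ b bᵐ n → b :* bᵐ :+ b :* (n :* bᵐ) := (con 1 :+ n) :* (b :* bᵐ)) refl b (b ^ m) n ⟩
    (1# + n) * (b * b ^ m) ∎
    where
    open ≡-Reasoning
    n : Carrier
    n = natMul (suc m) 1#

  eval-deriv-X : ∀ b → eval (deriv X) b ≡ 1#
  eval-deriv-X b = solve 1 (λ b → (con 1 :+ con 0) :+ b :* con 0 := con 1) refl b

  DegreeBelow : Pol → ℕ → Set
  DegreeBelow p k = ∀ i → k ℕ.≤ i → coeff p i ≡ 0#

  DegreeBelow-zero : ∀ p → DegreeBelow p 0 → p ≐ []
  DegreeBelow-zero p below i = below i z≤n

  DegreeBelow-mono : ∀ p {k l} → k ℕ.≤ l → DegreeBelow p k → DegreeBelow p l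
  DegreeBelow-mono p k≤l below i l≤i = below i (ℕ.≤-trans k≤l l≤i)

  DegreeBelow-∷ : ∀ c p {k} → DegreeBelow p k → DegreeBelow (c ∷ p) (suc k)
  DegreeBelow-∷ c p below zero    ()
  DegreeBelow-∷ c p below (suc i) (s≤s k≤i) = below i k≤i

  DegreeBelow-tail : ∀ c p {k} → DegreeBelow (c ∷ p) (suc k) → DegreeBelow p k
  DegreeBelow-tail c p below i k≤i = below (suc i) (s≤s k≤i)

  eval-≐[] : ∀ p b → p ≐ [] → eval p b ≡ 0#
  eval-≐[] []      b p≐0 = refl
  eval-≐[] (a ∷ p) b p≐0 = begin
    a + b * eval p b   ≡⟨ cong₂ (λ u v → u + b * v) (p≐0 0) (eval-≐[] p b (λ i → p≐0 (suc i))) ⟩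
    0# + b * 0#        ≡⟨ trans (+-identityˡ _) (zeroʳ b) ⟩
    0#                 ∎
    where open ≡-Reasoning

  -- The quotient of p by x − a, by synthetic division.
  quotient : Carrier → Pol → Pol
  quotient a []      = []
  quotient a (c ∷ p) = eval p a ∷ quotient a p

  -- p(b) − p(a) = (b − a) q(b), stated without subtraction so that it is a semiring identity.
  eval-quotient : ∀ a p b → eval p b + a * eval (quotient a p) b ≡ eval p a + b * eval (quotient a p) b
  eval-quotient a []      b = trans (cong (0# +_) (zeroʳ a)) (sym (cong (0# +_) (zeroʳ b)))
  eval-quotient a (c ∷ p) b = begin
    (c + b * eval p b) + a * (eval p a + b * Q)
      ≡⟨ solve 6 (λ c b Pb a Pa Q → (c :+ b :* Pb) :+ a :* (Pa :+ b :* Q) := (c :+ a :* Pa) :+ b :* (Pb :+ a :* Q)) refl c b (eval p b) a (eval p a) Q ⟩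
    (c + a * eval p a) + b * (eval p b + a * Q)
      ≡⟨ cong (λ u → (c + a * eval p a) + b * u) (eval-quotient a p b) ⟩
    (c + a * eval p a) + b * (eval p a + b * Q) ∎
    where
    open ≡-Reasoning
    Q : Carrier
    Q = eval (quotient a p) b

  -- The derivative of p(x) = p(a) + (x − a) q(x), in the same subtraction-free form.
  eval-deriv-quotient : ∀ a p b →
    eval (deriv p) b + a * eval (deriv (quotient a p)) b ≡ eval (quotient a p) b + b * eval (deriv (quotient a p)) b
  eval-deriv-quotient a []      b = trans (cong (0# +_) (zeroʳ a)) (sym (cong (0# +_) (zeroʳ b)))
  eval-deriv-quotient a (c ∷ p) b = begin
    eval (deriv (c ∷ p)) b + a * eval (deriv (eval p a ∷ quotient a p)) b
      ≡⟨ cong₂ (λ u v → u + a * v) (eval-deriv-∷ c p b) (eval-deriv-∷ (eval p a) (quotient a p) b) ⟩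
    (Pb + b * P′) + a * (Q + b * Q′)
      ≡⟨ solve 6 (λ Pb b P′ a Q Q′ → (Pb :+ b :* P′) :+ a :* (Q :+ b :* Q′) := (Pb :+ a :* Q) :+ b :* (P′ :+ a :* Q′)) refl Pb b P′ a Q Q′ ⟩
    (Pb + a * Q) + b * (P′ + a * Q′)
      ≡⟨ cong₂ (λ u v → u + b * v) (eval-quotient a p b) (eval-deriv-quotient a p b) ⟩
    (eval p a + b * Q) + b * (Q + b * Q′)
      ≡⟨ cong (λ u → eval (eval p a ∷ quotient a p) b + b * u) (eval-deriv-∷ (eval p a) (quotient a p) b) ⟨
    eval (eval p a ∷ quotient a p) b + b * eval (deriv (eval p a ∷ quotient a p)) b ∎
    where
    open ≡-Reasoning
    Pb P′ Q Q′ : Carrier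
    Pb = eval p b; P′ = eval (deriv p) b; Q = eval (quotient a p) b; Q′ = eval (deriv (quotient a p)) b

  quotient-≐[] : ∀ a p → p ≐ [] → quotient a p ≐ []
  quotient-≐[] a []      p≐0 i       = refl
  quotient-≐[] a (c ∷ p) p≐0 zero    = eval-≐[] p a (λ i → p≐0 (suc i))
  quotient-≐[] a (c ∷ p) p≐0 (suc i) = quotient-≐[] a p (λ j → p≐0 (suc j)) i

  DegreeBelow-quotient : ∀ a p k → DegreeBelow p k → DegreeBelow (quotient a p) (k ℕ.∸ 1)
  DegreeBelow-quotient a []      k             below i _ = refl
  DegreeBelow-quotient a (c ∷ p) zero          below i _ = quotient-≐[] a (c ∷ p) (DegreeBelow-zero (c ∷ p) below) i
  DegreeBelow-quotient a (c ∷ p) (suc zero)    below zero    _ = eval-≐[] p a (DegreeBelow-zero p (DegreeBelow-tail c p below))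
  DegreeBelow-quotient a (c ∷ p) (suc zero)    below (suc i) _ = quotient-≐[] a p (DegreeBelow-zero p (DegreeBelow-tail c p below)) i
  DegreeBelow-quotient a (c ∷ p) (suc (suc k)) below zero    ()
  DegreeBelow-quotient a (c ∷ p) (suc (suc k)) below (suc i) (s≤s k≤i) =
    DegreeBelow-quotient a p (suc k) (DegreeBelow-tail c p below) i k≤i

  quotient≐[]⇒≐[] : ∀ a p → eval p a ≡ 0# → quotient a p ≐ [] → p ≐ []
  quotient≐[]⇒≐[] a []      pa≡0 q≐0 i = refl
  quotient≐[]⇒≐[] a (c ∷ p) pa≡0 q≐0 zero = begin
    c                 ≡⟨ +-identityʳ c ⟨
    c + 0#            ≡⟨ cong (c +_) (zeroʳ a) ⟨
    c + a * 0#        ≡⟨ cong (λ u → c + a * u) (q≐0 0) ⟨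
    c + a * eval p a  ≡⟨ pa≡0 ⟩
    0#                ∎
    where open ≡-Reasoning
  quotient≐[]⇒≐[] a (c ∷ p) pa≡0 q≐0 (suc i) = quotient≐[]⇒≐[] a p (q≐0 0) (λ j → q≐0 (suc j)) i

  quotient-root : ∀ {a b} p → a ≢ b → eval p a ≡ 0# → eval p b ≡ 0# → eval (quotient a p) b ≡ 0#
  quotient-root {a} {b} p a≢b pa≡0 pb≡0 = shared-root a≢b pb≡0 pa≡0 (eval-quotient a p b)

  Root : Pol → Carrier → Set
  Root p a = eval p a ≡ 0#

  DoubleRoot : Pol → Carrier → Set
  DoubleRoot p a = Root p a × Root (deriv p) a

  roots⇒≐[] : ∀ p {k} as → DegreeBelow p k → k ℕ.≤ length as → Unique as → All (Root p) as → p ≐ []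
  roots⇒≐[] p       []       below k≤0 _ _ = DegreeBelow-zero p (DegreeBelow-mono p k≤0 below)
  roots⇒≐[] p {k} (a ∷ as) below k≤1+n (a∉as ∷ uniq) (pa≡0 ∷ roots) =
    quotient≐[]⇒≐[] a p pa≡0
      (roots⇒≐[] (quotient a p) as (DegreeBelow-quotient a p k below) (ℕ.∸-monoˡ-≤ 1 k≤1+n) uniq
        (All.zipWith (λ (a≢b , pb≡0) → quotient-root p a≢b pa≡0 pb≡0) (a∉as , roots)))

  double-root⇒quotient-root : ∀ {a} p → DoubleRoot p a → eval (quotient a p) a ≡ 0#
  double-root⇒quotient-root {a} p (_ , p′a≡0) = +-cancelʳ (a * eval (deriv q) a) (eval q a) 0#
    (trans (sym (eval-deriv-quotient a p a)) (cong (_+ a * eval (deriv q) a) p′a≡0))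
    where
    q : Pol
    q = quotient a p

  double-quotient-root : ∀ {a b} p → a ≢ b → DoubleRoot p a → DoubleRoot p b →
    DoubleRoot (quotient a (quotient a p)) b
  double-quotient-root {a} {b} p a≢b a-root@(pa≡0 , _) (pb≡0 , p′b≡0) = qqb≡0 , q′q′b≡0
    where
    q : Pol
    q = quotient a p
    qb≡0 : eval q b ≡ 0#
    qb≡0 = quotient-root p a≢b pa≡0 pb≡0
    qqb≡0 : eval (quotient a q) b ≡ 0#
    qqb≡0 = quotient-root q a≢b (double-root⇒quotient-root p a-root) qb≡0
    q′b≡0 : eval (deriv q) b ≡ 0#
    q′b≡0 = shared-root a≢b p′b≡0 qb≡0 (eval-deriv-quotient a p b)
    q′q′b≡0 : eval (deriv (quotient a q)) b ≡ 0#
    q′q′b≡0 = shared-root a≢b q′b≡0 qqb≡0 (eval-deriv-quotient a q b)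

  double-roots⇒≐[] : ∀ p {k} as → DegreeBelow p k → k ℕ.≤ length as ℕ.+ length as → Unique as →
    All (DoubleRoot p) as → p ≐ []
  double-roots⇒≐[] p       []       below k≤0 _ _ = DegreeBelow-zero p (DegreeBelow-mono p k≤0 below)
  double-roots⇒≐[] p {k} (a ∷ as) below k≤2+2n (a∉as ∷ uniq) (a-root ∷ roots) =
    quotient≐[]⇒≐[] a p (proj₁ a-root) (quotient≐[]⇒≐[] a q (double-root⇒quotient-root p a-root)
      (double-roots⇒≐[] (quotient a q) as below″ k∸2≤2n uniq
        (All.zipWith (λ (a≢b , b-root) → double-quotient-root p a≢b a-root b-root) (a∉as , roots))))
    where
    q : Pol
    q = quotient a p
    n : ℕ
    n = length as
    below″ : DegreeBelow (quotient a q) (k ℕ.∸ 1 ℕ.∸ 1)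
    below″ = DegreeBelow-quotient a q (k ℕ.∸ 1) (DegreeBelow-quotient a p k below)
    k∸2≤2n : k ℕ.∸ 1 ℕ.∸ 1 ℕ.≤ n ℕ.+ n
    k∸2≤2n = ℕ.∸-monoˡ-≤ 1 (ℕ.≤-trans (ℕ.∸-monoˡ-≤ 1 k≤2+2n) (ℕ.≤-reflexive (ℕ.+-suc n n)))

  coeff-add : ∀ p r i → coeff (add p r) i ≡ coeff p i + coeff r i
  coeff-add []      r       i       = sym (+-identityˡ _)
  coeff-add (a ∷ p) []      i       = sym (+-identityʳ _)
  coeff-add (a ∷ p) (c ∷ r) zero    = refl
  coeff-add (a ∷ p) (c ∷ r) (suc i) = coeff-add p r i

  coeff-neg : ∀ p i → coeff (neg p) i ≡ - coeff p i
  coeff-neg []      i       = sym -0#≈0#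
  coeff-neg (a ∷ p) zero    = refl
  coeff-neg (a ∷ p) (suc i) = coeff-neg p i

  coeff-sub : ∀ p r i → coeff (sub p r) i ≡ coeff p i - coeff r i
  coeff-sub p r i = trans (coeff-add p (neg r) i) (cong (coeff p i +_) (coeff-neg r i))

  coeff-scale : ∀ c p i → coeff (scale c p) i ≡ c * coeff p i
  coeff-scale c []      i       = sym (zeroʳ c)
  coeff-scale c (a ∷ p) zero    = refl
  coeff-scale c (a ∷ p) (suc i) = coeff-scale c p i

  coeff-mul-∷ : ∀ a p r i → coeff (mul (a ∷ p) r) i ≡ a * coeff r i + coeff (0# ∷ mul p r) i
  coeff-mul-∷ a p r i = trans (coeff-add (scale a r) (0# ∷ mul p r) i) (cong (_+ _) (coeff-scale a r i))

  ≐[]-∷ : ∀ p → p ≐ [] → (0# ∷ p) ≐ []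
  ≐[]-∷ p p≐0 zero    = refl
  ≐[]-∷ p p≐0 (suc i) = p≐0 i

  mul-≐[] : ∀ p r → p ≐ [] → mul p r ≐ []
  mul-≐[] []      r p≐0 i = refl
  mul-≐[] (a ∷ p) r p≐0 i = begin
    coeff (mul (a ∷ p) r) i
      ≡⟨ coeff-mul-∷ a p r i ⟩
    a * coeff r i + coeff (0# ∷ mul p r) i
      ≡⟨ cong₂ (λ u v → u * coeff r i + v) (p≐0 0) (≐[]-∷ (mul p r) (mul-≐[] p r (λ j → p≐0 (suc j))) i) ⟩
    0# * coeff r i + 0#
      ≡⟨ trans (+-identityʳ _) (zeroˡ _) ⟩
    0# ∎
    where open ≡-Reasoning

  DegreeBelow-add : ∀ p r k → DegreeBelow p k → DegreeBelow r k → DegreeBelow (add p r) k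
  DegreeBelow-add p r k p-below r-below i k≤i =
    trans (coeff-add p r i) (trans (cong₂ _+_ (p-below i k≤i) (r-below i k≤i)) (+-identityˡ 0#))

  DegreeBelow-sub : ∀ p r k → DegreeBelow p k → DegreeBelow r k → DegreeBelow (sub p r) k
  DegreeBelow-sub p r k p-below r-below = DegreeBelow-add p (neg r) k p-below
    (λ i k≤i → trans (coeff-neg r i) (trans (cong -_ (r-below i k≤i)) -0#≈0#))

  DegreeBelow-scale : ∀ c p k → DegreeBelow p k → DegreeBelow (scale c p) k
  DegreeBelow-scale c p k below i k≤i = trans (coeff-scale c p i) (trans (cong (c *_) (below i k≤i)) (zeroʳ c))

  DegreeBelow-mul : ∀ p r k l → DegreeBelow p (suc k) → DegreeBelow r (suc l) → DegreeBelow (mul p r) (suc (k ℕ.+ l))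
  DegreeBelow-mul []      r k       l p-below r-below i _ = refl
  DegreeBelow-mul (a ∷ p) r zero    l p-below r-below =
    DegreeBelow-add (scale a r) (0# ∷ mul p r) (suc l) (DegreeBelow-scale a r (suc l) r-below)
      (λ i _ → ≐[]-∷ (mul p r) (mul-≐[] p r (DegreeBelow-zero p (DegreeBelow-tail a p p-below))) i)
  DegreeBelow-mul (a ∷ p) r (suc k) l p-below r-below =
    DegreeBelow-add (scale a r) (0# ∷ mul p r) (suc (suc k ℕ.+ l))
      (DegreeBelow-mono (scale a r) (s≤s (ℕ.m≤n+m l (suc k))) (DegreeBelow-scale a r (suc l) r-below))
      (DegreeBelow-∷ 0# (mul p r) (DegreeBelow-mul p r k l (DegreeBelow-tail a p p-below) r-below))

  coeff-mul-top : ∀ p r k l → DegreeBelow p (suc k) → DegreeBelow r (suc l) →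
    coeff (mul p r) (k ℕ.+ l) ≡ coeff p k * coeff r l
  coeff-mul-top []      r k       l p-below r-below = sym (zeroˡ _)
  coeff-mul-top (a ∷ p) r zero    l p-below r-below = begin
    coeff (mul (a ∷ p) r) l
      ≡⟨ coeff-mul-∷ a p r l ⟩
    a * coeff r l + coeff (0# ∷ mul p r) l
      ≡⟨ cong (a * coeff r l +_) (≐[]-∷ (mul p r) (mul-≐[] p r (DegreeBelow-zero p (DegreeBelow-tail a p p-below))) l) ⟩
    a * coeff r l + 0#
      ≡⟨ +-identityʳ _ ⟩
    a * coeff r l ∎
    where open ≡-Reasoning
  coeff-mul-top (a ∷ p) r (suc k) l p-below r-below = begin
    coeff (mul (a ∷ p) r) (suc k ℕ.+ l)
      ≡⟨ coeff-mul-∷ a p r (suc k ℕ.+ l) ⟩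
    a * coeff r (suc k ℕ.+ l) + coeff (mul p r) (k ℕ.+ l)
      ≡⟨ cong₂ (λ u v → a * u + v) (r-below _ (s≤s (ℕ.m≤n+m l k))) (coeff-mul-top p r k l (DegreeBelow-tail a p p-below) r-below) ⟩
    a * 0# + coeff p k * coeff r l
      ≡⟨ trans (cong (_+ coeff p k * coeff r l) (zeroʳ a)) (+-identityˡ _) ⟩
    coeff p k * coeff r l ∎
    where open ≡-Reasoning

  DegreeBelow-pow : ∀ p d k → DegreeBelow p (suc d) → DegreeBelow (pow p k) (suc (k ℕ.* d))
  DegreeBelow-pow p d zero    below = DegreeBelow-∷ 1# [] (λ _ _ → refl)
  DegreeBelow-pow p d (suc k) below = DegreeBelow-mul p (pow p k) d (k ℕ.* d) below (DegreeBelow-pow p d k below)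

  coeff-pow-top : ∀ p d k → DegreeBelow p (suc d) → coeff (pow p k) (k ℕ.* d) ≡ coeff p d ^ k
  coeff-pow-top p d zero    below = refl
  coeff-pow-top p d (suc k) below =
    trans (coeff-mul-top p (pow p k) d (k ℕ.* d) below (DegreeBelow-pow p d k below))
          (cong (coeff p d *_) (coeff-pow-top p d k below))

  DegreeBelow-monomial : ∀ m → DegreeBelow (monomial m) (suc m)
  DegreeBelow-monomial zero    = DegreeBelow-∷ 1# [] (λ _ _ → refl)
  DegreeBelow-monomial (suc m) = DegreeBelow-∷ 0# (monomial m) (DegreeBelow-monomial m)

  DegreeBelow-X : DegreeBelow X 2
  DegreeBelow-X = DegreeBelow-∷ 0# (1# ∷ []) (DegreeBelow-∷ 1# [] (λ _ _ → refl))

  DegreeBelow-deriv : ∀ p d → DegreeBelow p (suc d) → DegreeBelow (deriv p) d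
  DegreeBelow-deriv []      d below i _ = refl
  DegreeBelow-deriv (a ∷ p) d below = derivAux-below 1 p d (DegreeBelow-tail a p below)
    where
    derivAux-below : ∀ i p d → DegreeBelow p d → DegreeBelow (derivAux i p) d
    derivAux-below i []      d below j _ = refl
    derivAux-below i (a ∷ p) d below zero    d≤0 = trans (cong (natMul i) (below 0 d≤0)) (natMul-0# i)
    derivAux-below i (a ∷ p) zero    below (suc j) _ = derivAux-below (suc i) p 0 (λ j _ → below (suc j) z≤n) j z≤n
    derivAux-below i (a ∷ p) (suc d) below (suc j) (s≤s d≤j) = derivAux-below (suc i) p d (DegreeBelow-tail a p below) j d≤j

  isZero⇒≐[] : ∀ p → isZero p ≡ true → p ≐ []
  isZero⇒≐[] []      _ i = refl
  isZero⇒≐[] (a ∷ p) e i with a ≟ 0#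
  isZero⇒≐[] (a ∷ p) e zero    | yes a≡0 = a≡0
  isZero⇒≐[] (a ∷ p) e (suc i) | yes _   = isZero⇒≐[] p e i
  isZero⇒≐[] (a ∷ p) () i      | no _

  DegreeBelow-deg : ∀ p → DegreeBelow p (suc (deg p))
  DegreeBelow-deg []      i _ = refl
  DegreeBelow-deg (a ∷ p) i le with isZero p in eq
  DegreeBelow-deg (a ∷ p) zero    ()        | true
  DegreeBelow-deg (a ∷ p) (suc i) _         | true  = isZero⇒≐[] p eq i
  DegreeBelow-deg (a ∷ p) zero    ()        | false
  DegreeBelow-deg (a ∷ p) (suc i) (s≤s le)  | false = DegreeBelow-deg p i le

  leading-coeff-≢0 : ∀ p → 1 ℕ.≤ deg p → coeff p (deg p) ≢ 0#
  leading-coeff-≢0 p 1≤deg = nonzero p (deg≥1⇒nonzero p 1≤deg)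
    where
    nonzero : ∀ p → isZero p ≡ false → coeff p (deg p) ≢ 0#
    nonzero []      ()
    nonzero (a ∷ p) e with isZero p in eq
    nonzero (a ∷ p) e | true with a ≟ 0#
    nonzero (a ∷ p) () | true | yes _
    nonzero (a ∷ p) e  | true | no a≢0 = a≢0
    nonzero (a ∷ p) e | false = nonzero p eq

    deg≥1⇒nonzero : ∀ p → 1 ℕ.≤ deg p → isZero p ≡ false
    deg≥1⇒nonzero []      ()
    deg≥1⇒nonzero (a ∷ p) le with isZero p
    deg≥1⇒nonzero (a ∷ p) () | true
    deg≥1⇒nonzero (a ∷ p) le | false with a ≟ 0#
    ... | yes _ = refl
    ... | no  _ = refl

module FiniteFieldLemmas (L : FiniteField) where
  open FieldLemmas L
  open Poly L using (natMul)
  open CommutativeMonoidSum +-commutativeMonoid using (∑-distrib-+) renaming (sum to ∑)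
  open CommutativeMonoidSum *-commutativeMonoid using ()
    renaming (sum to ∏; ∑-distrib-+ to ∏-distrib-*; sum-remove to ∏-remove;
              sum-cong-≗ to ∏-cong-≗; sum-replicate-zero to ∏-replicate-1)

  element : Fin size → Carrier
  element = Inverse.to enum

  index : Carrier → Fin size
  index = Inverse.from enum

  element-index : ∀ x → element (index x) ≡ x
  element-index = Inverse.strictlyInverseˡ enum

  element-injective : ∀ {i j} → element i ≡ element j → i ≡ j
  element-injective = Injection.injective (↔⇒↣ enum)

  module _ (M : CommutativeMonoid 0ℓ 0ℓ) where
    private
      module M = CommutativeMonoid M
      module Sum = CommutativeMonoidSum M

    reindex : (h : Carrier ↔ Carrier) (f : Carrier → M.Carrier) →
      Sum.sum (f ∘ element) M.≈ Sum.sum (f ∘ Inverse.to h ∘ element)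
    reindex h f = M.trans (Sum.sum-permute (f ∘ element) (↔-sym enum ↔-∘ (h ↔-∘ enum)))
                          (M.reflexive (Sum.sum-cong-≗ (λ i → cong f (element-index (Inverse.to h (element i))))))

  ∑-const : ∀ n c → ∑ {n} (λ _ → c) ≡ natMul n c
  ∑-const zero    c = refl
  ∑-const (suc n) c = cong (c +_) (∑-const n c)

  ∏-const : ∀ n c → ∏ {n} (λ _ → c) ≡ c ^ n
  ∏-const zero    c = refl
  ∏-const (suc n) c = cong (c *_) (∏-const n c)

  ∏-single : ∀ {n} (t : Fin n → Carrier) i → (∀ j → j ≢ i → t j ≡ 1#) → ∏ t ≡ t i
  ∏-single {suc n} t i others≡1 = begin
    ∏ t                                   ≡⟨ ∏-remove {i = i} t ⟩
    t i * ∏ (λ j → t (punchIn i j))       ≡⟨ cong (t i *_) (∏-cong-≗ (λ j → others≡1 _ (punchInᵢ≢i i j))) ⟩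
    t i * ∏ {n} (λ _ → 1#)                ≡⟨ cong (t i *_) (∏-replicate-1 n) ⟩
    t i * 1#                              ≡⟨ *-identityʳ _ ⟩
    t i                                   ∎
    where open ≡-Reasoning

  ∏-≢0 : ∀ {n} (t : Fin n → Carrier) → (∀ i → t i ≢ 0#) → ∏ t ≢ 0#
  ∏-≢0 {zero}  t t≢0 1≡0 = 0≢1 (sym 1≡0)
  ∏-≢0 {suc n} t t≢0 ∏≡0 = ∏-≢0 (t ∘ suc) (t≢0 ∘ suc) (x*y≡0⇒y≡0 (t≢0 zero) ∏≡0)

  translation : Carrier → Carrier ↔ Carrier
  translation c = mk↔ₛ′ (_+ c) (_- c) (λ x → cancel x c (- c) (-‿inverseˡ c)) (λ x → cancel x (- c) c (-‿inverseʳ c))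
    where
    cancel : ∀ x y z → z + y ≡ 0# → x + z + y ≡ x
    cancel x y z z+y≡0 = trans (+-assoc x z y) (trans (cong (x +_) z+y≡0) (+-identityʳ x))

  dilation : ∀ {a} → a ≢ 0# → Carrier ↔ Carrier
  dilation {a} a≢0 with inverse a a≢0
  ... | a⁻¹ , aa⁻¹≡1 = mk↔ₛ′ (a *_) (a⁻¹ *_) (cancel a a⁻¹ aa⁻¹≡1) (cancel a⁻¹ a (trans (*-comm a⁻¹ a) aa⁻¹≡1))
    where
    cancel : ∀ x y → x * y ≡ 1# → ∀ z → x * (y * z) ≡ z
    cancel x y xy≡1 z = trans (sym (*-assoc x y z)) (trans (cong (_* z) xy≡1) (*-identityˡ z))

  -- Translating every element by 1 permutes the field, so ∑ x = ∑ (x + 1) = ∑ x + |L|·1.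
  size·1≡0 : natMul size 1# ≡ 0#
  size·1≡0 = +-cancelˡ S (natMul size 1#) 0# (begin
    S + natMul size 1#          ≡⟨ cong (S +_) (∑-const size 1#) ⟨
    S + ∑ {size} (λ _ → 1#)     ≡⟨ ∑-distrib-+ element (λ _ → 1#) ⟨
    ∑ (λ i → element i + 1#)    ≡⟨ reindex +-commutativeMonoid (translation 1#) (λ x → x) ⟨
    S                           ≡⟨ +-identityʳ S ⟨
    S + 0#                      ∎)
    where
    open ≡-Reasoning
    S : Carrier
    S = ∑ element

  nonzeroPart : Carrier → Carrier
  nonzeroPart x with x ≟ 0#
  ... | yes _ = 1#
  ... | no  _ = x

  nonzeroPart-≢0 : ∀ x → nonzeroPart x ≢ 0#
  nonzeroPart-≢0 x with x ≟ 0#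
  ... | yes _   = λ 1≡0 → 0≢1 (sym 1≡0)
  ... | no  x≢0 = x≢0

  zeroFactor : Carrier → Carrier → Carrier
  zeroFactor a x with x ≟ 0#
  ... | yes _ = a
  ... | no  _ = 1#

  *-nonzeroPart : ∀ {a} x → a ≢ 0# → a * nonzeroPart x ≡ zeroFactor a x * nonzeroPart (a * x)
  *-nonzeroPart {a} x a≢0 with x ≟ 0# | (a * x) ≟ 0#
  ... | yes _   | yes _    = refl
  ... | yes x≡0 | no ax≢0  = ⊥-elim (ax≢0 (trans (cong (a *_) x≡0) (zeroʳ a)))
  ... | no x≢0  | yes ax≡0 = ⊥-elim (x≢0 (x*y≡0⇒y≡0 a≢0 ax≡0))
  ... | no _    | no _     = sym (*-identityˡ _)

  zeroFactor-0# : ∀ a → zeroFactor a 0# ≡ a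
  zeroFactor-0# a with 0# ≟ 0#
  ... | yes _   = refl
  ... | no  0≢0 = ⊥-elim (0≢0 refl)

  zeroFactor-≢0 : ∀ a {x} → x ≢ 0# → zeroFactor a x ≡ 1#
  zeroFactor-≢0 a {x} x≢0 with x ≟ 0#
  ... | yes x≡0 = ⊥-elim (x≢0 x≡0)
  ... | no  _   = refl

  ∏-zeroFactor : ∀ a → ∏ (λ i → zeroFactor a (element i)) ≡ a
  ∏-zeroFactor a = trans (∏-single _ (index 0#) other≡1) (trans (cong (zeroFactor a) (element-index 0#)) (zeroFactor-0# a))
    where
    other≡1 : ∀ j → j ≢ index 0# → zeroFactor a (element j) ≡ 1#
    other≡1 j j≢ = zeroFactor-≢0 a (λ ej≡0 → j≢ (element-injective (trans ej≡0 (sym (element-index 0#)))))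

  -- Multiplication by a ≠ 0 permutes L, so ∏ ν(a x) = ∏ ν(x) ≠ 0 for ν = nonzeroPart; comparing with
  -- ∏ a ν(x) = a^|L| ∏ ν(x) gives a^|L| = a.
  ^size≡id : ∀ a → a ^ size ≡ a
  ^size≡id a with a ≟ 0#
  ... | yes a≡0 = trans (cong (_^ size) a≡0) (trans (0^size (index 0#)) (sym a≡0))
    where
    0^size : ∀ {n} → Fin n → 0# ^ n ≡ 0#
    0^size {suc n} _ = zeroˡ _
  ... | no a≢0 = *-cancelʳ-≢0 (∏-≢0 _ (nonzeroPart-≢0 ∘ element)) (begin
    a ^ size * P
      ≡⟨ cong (_* P) (∏-const size a) ⟨
    ∏ {size} (λ _ → a) * P
      ≡⟨ ∏-distrib-* (λ _ → a) (nonzeroPart ∘ element) ⟨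
    ∏ (λ i → a * nonzeroPart (element i))
      ≡⟨ ∏-cong-≗ (λ i → *-nonzeroPart (element i) a≢0) ⟩
    ∏ (λ i → zeroFactor a (element i) * nonzeroPart (a * element i))
      ≡⟨ ∏-distrib-* (λ i → zeroFactor a (element i)) (λ i → nonzeroPart (a * element i)) ⟩
    ∏ (λ i → zeroFactor a (element i)) * ∏ (λ i → nonzeroPart (a * element i))
      ≡⟨ cong₂ _*_ (∏-zeroFactor a) (sym (reindex *-commutativeMonoid (dilation a≢0) nonzeroPart)) ⟩
    a * P                                                         ∎)
    where
    open ≡-Reasoning
    P : Carrier
    P = ∏ (nonzeroPart ∘ element)

  2≤size : 2 ℕ.≤ size
  2≤size = two-distinct (index 0#) (index 1#)
    (λ eq → 0≢1 (trans (sym (element-index 0#)) (trans (cong element eq) (element-index 1#))))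
    where
    two-distinct : ∀ {n} (i j : Fin n) → i ≢ j → 2 ℕ.≤ n
    two-distinct {suc zero}    zero zero i≢j = ⊥-elim (i≢j refl)
    two-distinct {suc (suc n)} _    _    _   = ℕ.s≤s (ℕ.s≤s ℕ.z≤n)

module EmbeddingLemmas (E K : FiniteField) (ι : FiniteField.Carrier E → FiniteField.Carrier K)
                       (emb : IsFieldEmbedding E K ι) where
  open PolynomialLemmas K
  open IsFieldEmbedding emb
  private
    module E where
      open PolynomialLemmas E public
      open FiniteFieldLemmas E public

  ι-0# : ι E.0# ≡ 0#
  ι-0# = +-cancelʳ (ι E.0#) (ι E.0#) 0#
    (trans (sym (+-hom E.0# E.0#)) (trans (cong ι (E.+-identityˡ E.0#)) (sym (+-identityˡ _))))

  ι-natMul : ∀ m a → ι (E.natMul m a) ≡ natMul m (ι a)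
  ι-natMul zero    a = ι-0#
  ι-natMul (suc m) a = trans (+-hom a _) (cong (ι a +_) (ι-natMul m a))

  ι-^ : ∀ c m → ι (c E.^ m) ≡ ι c ^ m
  ι-^ c zero    = 1-hom
  ι-^ c (suc m) = trans (*-hom c _) (cong (ι c *_) (ι-^ c m))

  sizeᴱ·1≡0 : natMul E.size 1# ≡ 0#
  sizeᴱ·1≡0 = begin
    natMul E.size 1#         ≡⟨ cong (natMul E.size) 1-hom ⟨
    natMul E.size (ι E.1#)   ≡⟨ ι-natMul E.size E.1# ⟨
    ι (E.natMul E.size E.1#) ≡⟨ cong ι E.size·1≡0 ⟩
    ι E.0#                   ≡⟨ ι-0# ⟩
    0#                       ∎
    where open ≡-Reasoning

  ι-^sizeᴱ : ∀ c → ι c ^ E.size ≡ ι c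
  ι-^sizeᴱ c = trans (sym (ι-^ c E.size)) (cong ι (E.^size≡id c))

  ι∘element-injective : ∀ {i j} → ι (E.element i) ≡ ι (E.element j) → i ≡ j
  ι∘element-injective eq = E.element-injective (injective _ _ eq)

module Counting where
  open import Data.Nat using (_+_; _*_; _≤_)
  open import Data.Bool using (Bool; if_then_else_)
  open import Data.List using (tabulate)
  open CommutativeMonoidSum ℕ.+-0-commutativeMonoid using (sum-remove; sum-cong-≗; ∑-comm) renaming (sum to ∑)

  𝟙 : Bool → ℕ
  𝟙 b = if b then 1 else 0

  countFin≡∑ : ∀ m (f : Fin m → Bool) → countFin m f ≡ ∑ (𝟙 ∘ f)
  countFin≡∑ zero    f = refl
  countFin≡∑ (suc m) f = cong (𝟙 (f zero) +_) (countFin≡∑ m (f ∘ suc))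

  ∑-const : ∀ m c → ∑ {m} (λ _ → c) ≡ m * c
  ∑-const zero    c = refl
  ∑-const (suc m) c = cong (c +_) (∑-const m c)

  ∑-≤ : ∀ {m} (f : Fin m → ℕ) {d} → (∀ i → f i ≤ d) → ∑ f ≤ m * d
  ∑-≤ {zero}  f f≤d = z≤n
  ∑-≤ {suc m} f f≤d = ℕ.+-mono-≤ (f≤d zero) (∑-≤ (f ∘ suc) (f≤d ∘ suc))

  ∑-≤-with-zero : ∀ {m} (f : Fin m → ℕ) {d} i → f i ≡ 0 → (∀ j → f j ≤ d) → ∑ f + d ≤ m * d
  ∑-≤-with-zero {suc m} f {d} i fi≡0 f≤d = begin
    ∑ f + d
      ≡⟨ cong (_+ d) (trans (sum-remove {i = i} f) (cong (_+ ∑ (λ j → f (punchIn i j))) fi≡0)) ⟩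
    ∑ (λ j → f (punchIn i j)) + d
      ≤⟨ ℕ.+-monoˡ-≤ d (∑-≤ (λ j → f (punchIn i j)) (λ j → f≤d _)) ⟩
    m * d + d
      ≡⟨ ℕ.+-comm (m * d) d ⟩
    suc m * d ∎
    where open ℕ.≤-Reasoning

  𝟙-yes : ∀ {A : Set} (a? : Dec A) → A → 𝟙 ⌊ a? ⌋ ≡ 1
  𝟙-yes (yes _) _ = refl
  𝟙-yes (no ¬a) a = contradiction a ¬a

  𝟙-no : ∀ {A : Set} (a? : Dec A) → ¬ A → 𝟙 ⌊ a? ⌋ ≡ 0
  𝟙-no (yes a) ¬a = contradiction a ¬a
  𝟙-no (no _)  _  = refl

  count-unique : ∀ {m} {Q : Fin m → Set} (Q? : ∀ i → Dec (Q i)) i → Q i → (∀ j → Q j → j ≡ i) →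
    countFin m (⌊_⌋ ∘ Q?) ≡ 1
  count-unique {suc m} Q? i Qi unique = begin
    countFin (suc m) (⌊_⌋ ∘ Q?)                          ≡⟨ countFin≡∑ (suc m) (⌊_⌋ ∘ Q?) ⟩
    ∑ (𝟙 ∘ ⌊_⌋ ∘ Q?)                                     ≡⟨ sum-remove {i = i} (𝟙 ∘ ⌊_⌋ ∘ Q?) ⟩
    𝟙 ⌊ Q? i ⌋ + ∑ (λ j → 𝟙 ⌊ Q? (punchIn i j) ⌋)   ≡⟨ cong₂ _+_ (𝟙-yes (Q? i) Qi) (sum-cong-≗ others) ⟩
    1 + ∑ {m} (λ _ → 0)                                   ≡⟨ cong suc (∑-const m 0) ⟩
    1 + m * 0                                             ≡⟨ cong suc (ℕ.*-zeroʳ m) ⟩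
    1                                                     ∎
    where
    open ≡-Reasoning
    others : ∀ j → 𝟙 ⌊ Q? (punchIn i j) ⌋ ≡ 0
    others j = 𝟙-no (Q? _) (punchInᵢ≢i i j ∘ unique _)

  count-none : ∀ {m} {Q : Fin m → Set} (Q? : ∀ i → Dec (Q i)) → (∀ i → ¬ Q i) → countFin m (⌊_⌋ ∘ Q?) ≡ 0
  count-none {zero}  Q? ¬Q = refl
  count-none {suc m} Q? ¬Q with Q? zero
  ... | yes Q₀ = contradiction Q₀ (¬Q zero)
  ... | no  _  = count-none (Q? ∘ suc) (¬Q ∘ suc)

  length-filter-tabulate : ∀ {p} {A : Set} {P : Pred A p} (P? : Decidable P) {m} (g : Fin m → A) →
    length (filter P? (tabulate g)) ≡ countFin m (⌊_⌋ ∘ P? ∘ g)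
  length-filter-tabulate P? {zero}  g = refl
  length-filter-tabulate P? {suc m} g with P? (g zero)
  ... | yes _ = cong suc (length-filter-tabulate P? (g ∘ suc))
  ... | no  _ = length-filter-tabulate P? (g ∘ suc)

  double-count : ∀ {m n} {R : Fin m → Fin n → Set} (R? : ∀ i j → Dec (R i j)) (partner : Fin m → Fin n) →
    (∀ i → R i (partner i)) → (∀ i j → R i j → j ≡ partner i) →
    ∑ (λ j → countFin m (λ i → ⌊ R? i j ⌋)) ≡ m
  double-count {m} {n} R? partner R-partner unique = begin
    ∑ (λ j → countFin m (λ i → ⌊ R? i j ⌋))   ≡⟨ sum-cong-≗ (λ j → countFin≡∑ m (λ i → ⌊ R? i j ⌋)) ⟩
    ∑ (λ j → ∑ (λ i → 𝟙 ⌊ R? i j ⌋))         ≡⟨ ∑-comm (λ j i → 𝟙 ⌊ R? i j ⌋) ⟩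
    ∑ (λ i → ∑ (λ j → 𝟙 ⌊ R? i j ⌋))        ≡⟨ sum-cong-≗ (λ i → countFin≡∑ n (⌊_⌋ ∘ R? i)) ⟨
    ∑ (λ i → countFin n (⌊_⌋ ∘ R? i))           ≡⟨ sum-cong-≗ (λ i → count-unique (R? i) (partner i) (R-partner i) (unique i)) ⟩
    ∑ {m} (λ _ → 1)                              ≡⟨ ∑-const m 1 ⟩
    m * 1                                        ≡⟨ ℕ.*-identityʳ m ⟩
    m                                            ∎
    where open ≡-Reasoning

module NatLemmas where
  open import Data.Nat using (_+_; _*_; _^_; _∸_; _≤_; _<_)
  open import Data.Nat.DivMod using (m/n*n≤m; m<n*o⇒m/o<n; m*n/n≡m; /-monoˡ-≤)

  ≤floorDiv⇔*≤ : ∀ d m k → 1 ≤ k → (d ≤ floorDiv m k) ⇔ (d * k ≤ m)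
  ≤floorDiv⇔*≤ d m (suc k) _ = mk⇔
    (λ d≤m/k → ℕ.≤-trans (ℕ.*-monoˡ-≤ (suc k) d≤m/k) (m/n*n≤m m (suc k)))
    (λ dk≤m → ℕ.≤-trans (ℕ.≤-reflexive (sym (m*n/n≡m d (suc k)))) (/-monoˡ-≤ (suc k) dk≤m))

  d*[q∸1]≤Q∸1⇔q*d<Q+d : ∀ q Q d → 1 ≤ q → 1 ≤ Q → (d * (q ∸ 1) ≤ Q ∸ 1) ⇔ (q * d < Q + d)
  d*[q∸1]≤Q∸1⇔q*d<Q+d (suc k) (suc m) d _ _ = mk⇔
    (λ dk≤m → s≤s (ℕ.≤-trans (ℕ.+-monoʳ-≤ d (ℕ.≤-trans (ℕ.≤-reflexive (ℕ.*-comm k d)) dk≤m))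
                             (ℕ.≤-reflexive (ℕ.+-comm d m))))
    (λ { (s≤s d+kd≤m+d) → ℕ.≤-trans (ℕ.≤-reflexive (ℕ.*-comm d k))
           (ℕ.+-cancelˡ-≤ d _ _ (ℕ.≤-trans d+kd≤m+d (ℕ.≤-reflexive (ℕ.+-comm m d)))) })

  floorDiv≡⇔*≤ : ∀ m d k → 1 ≤ d → m < suc k * d → (floorDiv m d ≡ k) ⇔ (k * d ≤ m)
  floorDiv≡⇔*≤ m d@(suc _) k 1≤d m<[1+k]d = mk⇔
    (λ m/d≡k → Equivalence.to (≤floorDiv⇔*≤ k m d 1≤d) (ℕ.≤-reflexive (sym m/d≡k)))
    (λ kd≤m → ℕ.≤-antisym (ℕ.≤-pred (m<n*o⇒m/o<n m<[1+k]d)) (Equivalence.from (≤floorDiv⇔*≤ k m d 1≤d) kd≤m))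

  q≡1+floorDiv⇔q*d<Q+d : ∀ q Q d → 1 ≤ q → 1 ≤ Q → 1 ≤ d → Q ≤ q * d →
    (q ≡ suc (floorDiv (Q ∸ 1) d)) ⇔ (q * d < Q + d)
  q≡1+floorDiv⇔q*d<Q+d q@(suc k) Q@(suc m) d 1≤q 1≤Q 1≤d Q≤qd =
    ⇔-trans (mk⇔ (sym ∘ ℕ.suc-injective) (cong suc ∘ sym))
   (⇔-trans (floorDiv≡⇔*≤ m d k 1≤d Q≤qd)
   (⇔-trans (mk⇔ (subst (_≤ m) (ℕ.*-comm k d)) (subst (_≤ m) (ℕ.*-comm d k)))
            (d*[q∸1]≤Q∸1⇔q*d<Q+d q Q d 1≤q 1≤Q)))

  d≤floorDiv⇔q*d<Q+d : ∀ q Q d → 2 ≤ q → 1 ≤ Q → (d ≤ floorDiv (Q ∸ 1) (q ∸ 1)) ⇔ (q * d < Q + d)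
  d≤floorDiv⇔q*d<Q+d q@(suc k) Q d (s≤s 1≤k) 1≤Q =
    ⇔-trans (≤floorDiv⇔*≤ d (Q ∸ 1) k 1≤k) (d*[q∸1]≤Q∸1⇔q*d<Q+d q Q d (s≤s z≤n) 1≤Q)

  q^n≤q*d⇒q^[n∸1]≤d : ∀ q n d → 1 ≤ q → 1 ≤ n → q ^ n ≤ q * d → q ^ (n ∸ 1) ≤ d
  q^n≤q*d⇒q^[n∸1]≤d (suc k) (suc n) d _ _ = ℕ.*-cancelˡ-≤ (suc k)

  d<q*d : ∀ q d → 2 ≤ q → 1 ≤ d → d < q * d
  d<q*d q d@(suc _) 2≤q@(s≤s (s≤s _)) _ = ℕ.<-≤-trans (ℕ.m<m*n d q 2≤q) (ℕ.≤-reflexive (ℕ.*-comm d q))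

  *<+⇒< : ∀ q Q d → 2 ≤ q → q * d < Q + d → d < Q
  *<+⇒< (suc (suc k)) Q d (s≤s (s≤s _)) qd<Q+d = ℕ.+-cancelʳ-< d d Q (ℕ.≤-<-trans (ℕ.+-monoʳ-≤ d (ℕ.m≤m+n d (k * d))) qd<Q+d)

module ValueSet (Fq K : FiniteField) (ι : FiniteField.Carrier Fq → FiniteField.Carrier K)
                (emb : IsFieldEmbedding Fq K ι) (F : Poly.Pol K) (1≤deg : 1 ℕ.≤ Poly.deg K F)
                (values : ∀ a → ∃[ c ] (ι c ≡ Poly.eval K F a)) where
  open PolynomialLemmas K
  open FiniteFieldLemmas K using (element; index; element-index; element-injective; size·1≡0; ^size≡id; 2≤size)
  open EmbeddingLemmas Fq K ι emb
  open Counting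
  open NatLemmas
  open CommutativeMonoidSum ℕ.+-0-commutativeMonoid using (sum-cong-≗) renaming (sum to ∑)
  private
    module Fq where
      open FiniteField Fq public
      open FiniteFieldLemmas Fq public

  DegreeBound : Set
  DegreeBound = Fq.size ℕ.* deg F ℕ.< size ℕ.+ deg F

  Surjective : Set
  Surjective = ∀ b → ∃[ a ] (eval F a ≡ ι b)

  fibreSize : Carrier → ℕ
  fibreSize y = countFin size (λ i → ⌊ eval F (element i) ≟ y ⌋)

  fibreSize≤deg : ∀ y → fibreSize y ℕ.≤ deg F
  fibreSize≤deg y = ℕ.≮⇒≥ (λ deg<fibre → leading-coeff-≢0 F 1≤deg (leading≡0 deg<fibre))
    where
    G : Pol
    G = sub F (y ∷ [])
    const-below : DegreeBelow (y ∷ []) 1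
    const-below = DegreeBelow-∷ y [] (λ _ _ → refl)
    G-below : DegreeBelow G (suc (deg F))
    G-below = DegreeBelow-sub F (y ∷ []) (suc (deg F)) (DegreeBelow-deg F) (DegreeBelow-mono (y ∷ []) (s≤s z≤n) const-below)
    G-root : ∀ x → eval F x ≡ y → Root G x
    G-root x Fx≡y = begin
      eval G x                  ≡⟨ eval-sub F (y ∷ []) x ⟩
      eval F x - (y + x * 0#)   ≡⟨ cong₂ (λ u v → u - (y + v)) Fx≡y (zeroʳ x) ⟩
      y - (y + 0#)              ≡⟨ cong (λ u → y - u) (+-identityʳ y) ⟩
      y - y                     ≡⟨ -‿inverseʳ y ⟩
      0#                        ∎
      where open ≡-Reasoning
    fibre? : ∀ i → Dec (eval F (element i) ≡ y)
    fibre? i = eval F (element i) ≟ y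
    roots : List Carrier
    roots = map element (filter fibre? (allFin size))
    length-roots : length roots ≡ fibreSize y
    length-roots = trans (List.length-map element (filter fibre? (allFin size))) (length-filter-tabulate fibre? (λ i → i))
    G≐0 : deg F ℕ.< fibreSize y → G ≐ []
    G≐0 deg<fibre = roots⇒≐[] G roots G-below (ℕ.≤-trans deg<fibre (ℕ.≤-reflexive (sym length-roots)))
      (Unique.map⁺ element-injective (Unique.filter⁺ fibre? (Unique.allFin⁺ size)))
      (All.map⁺ (All.map (G-root _) (All.all-filter fibre? (allFin size))))
    leading≡0 : deg F ℕ.< fibreSize y → coeff F (deg F) ≡ 0#
    leading≡0 deg<fibre = trans
      (x∙y⁻¹≈ε⇒x≈y _ _ (trans (sym (coeff-sub F (y ∷ []) (deg F))) (G≐0 deg<fibre (deg F))))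
      (const-below (deg F) 1≤deg)

  ∑-fibreSize : ∑ (λ c → fibreSize (ι (Fq.element c))) ≡ size
  ∑-fibreSize = double-count (λ i c → eval F (element i) ≟ ι (Fq.element c)) value value-correct value-unique
    where
    value : Fin size → Fin Fq.size
    value i = Fq.index (proj₁ (values (element i)))
    value-correct : ∀ i → eval F (element i) ≡ ι (Fq.element (value i))
    value-correct i = trans (sym (proj₂ (values (element i)))) (cong ι (sym (Fq.element-index _)))
    value-unique : ∀ i c → eval F (element i) ≡ ι (Fq.element c) → c ≡ value i
    value-unique i c eq = ι∘element-injective (trans (sym eq) (value-correct i))

  size≤q*deg : size ℕ.≤ Fq.size ℕ.* deg F
  size≤q*deg = subst (ℕ._≤ Fq.size ℕ.* deg F) ∑-fibreSize (∑-≤ (λ c → fibreSize (ι (Fq.element c))) (λ c → fibreSize≤deg _))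

  missing-value : ∀ b → ¬ (∃[ a ] (eval F a ≡ ι b)) → size ℕ.+ deg F ℕ.≤ Fq.size ℕ.* deg F
  missing-value b no-preimage =
    subst (λ s → s ℕ.+ deg F ℕ.≤ Fq.size ℕ.* deg F) ∑-fibreSize
      (∑-≤-with-zero (λ c → fibreSize (ι (Fq.element c))) (Fq.index b) empty-fibre (λ c → fibreSize≤deg _))
    where
    empty-fibre : fibreSize (ι (Fq.element (Fq.index b))) ≡ 0
    empty-fibre = count-none (λ i → eval F (element i) ≟ ι (Fq.element (Fq.index b)))
      (λ i eq → no-preimage (element i , trans eq (cong ι (Fq.element-index b))))

  surjective : DegreeBound → Surjective
  surjective qd<Q+d b with any? (λ i → eval F (element i) ≟ ι b)
  ... | yes (i , eq) = element i , eq
  ... | no none = ⊥-elim (ℕ.<⇒≱ qd<Q+d (missing-value b λ (a , eq) →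
                    none (index a , trans (cong (eval F) (element-index a)) eq)))

  valueSetSize≡q : Surjective → valueSetSize F ≡ Fq.size
  valueSetSize≡q surj = begin
    valueSetSize F
      ≡⟨ countFin≡∑ size _ ⟩
    ∑ (λ j → 𝟙 ⌊ any? (λ i → eval F (element i) ≟ element j) ⌋)
      ≡⟨ sum-cong-≗ image-indicator ⟩
    ∑ (λ j → countFin Fq.size (λ c → ⌊ ι (Fq.element c) ≟ element j ⌋))
      ≡⟨ double-count (λ c j → ι (Fq.element c) ≟ element j) position (λ c → sym (element-index _))
           (λ c j eq → element-injective (trans (sym eq) (sym (element-index _)))) ⟩
    Fq.size ∎
    where
    open ≡-Reasoning
    position : Fin Fq.size → Fin size
    position c = index (ι (Fq.element c))
    image-indicator : ∀ j → 𝟙 ⌊ any? (λ i → eval F (element i) ≟ element j) ⌋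
                          ≡ countFin Fq.size (λ c → ⌊ ι (Fq.element c) ≟ element j ⌋)
    image-indicator j with any? (λ i → eval F (element i) ≟ element j)
    ... | yes (i , Fi≡j) = sym (count-unique _ c₀ ιc₀≡j (λ c ιc≡j → ι∘element-injective (trans ιc≡j (sym ιc₀≡j))))
      where
      c₀ : Fin Fq.size
      c₀ = Fq.index (proj₁ (values (element i)))
      ιc₀≡j : ι (Fq.element c₀) ≡ element j
      ιc₀≡j = trans (cong ι (Fq.element-index _)) (trans (proj₂ (values (element i))) Fi≡j)
    ... | no none = sym (count-none _ λ c ιc≡j →
            none (index (proj₁ (surj (Fq.element c))) ,
                  trans (cong (eval F) (element-index _)) (trans (proj₂ (surj (Fq.element c))) ιc≡j)))

  W : Pol
  W = sub (monomial size) X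

  Δ : Pol
  Δ = sub (sub (pow F Fq.size) F) (mul W (deriv F))

  eval-W : ∀ x → eval W x ≡ 0#
  eval-W x = begin
    eval W x                                  ≡⟨ eval-sub (monomial size) X x ⟩
    eval (monomial size) x - eval X x         ≡⟨ cong₂ _-_ (trans (eval-monomial size x) (^size≡id x)) (eval-X x) ⟩
    x - x                                     ≡⟨ -‿inverseʳ x ⟩
    0#                                        ∎
    where open ≡-Reasoning

  eval-deriv-W : ∀ x → eval (deriv W) x ≡ - 1#
  eval-deriv-W x = begin
    eval (deriv W) x                                          ≡⟨ eval-deriv-sub (monomial size) X x ⟩
    eval (deriv (monomial size)) x - eval (deriv X) x         ≡⟨ cong₂ _-_ (eval-deriv-monomial size x) (eval-deriv-X x) ⟩
    natMul size 1# * x ^ (size ℕ.∸ 1) - 1#                    ≡⟨ cong (λ u → u * x ^ (size ℕ.∸ 1) - 1#) size·1≡0 ⟩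
    0# * x ^ (size ℕ.∸ 1) - 1#                                ≡⟨ trans (cong (_- 1#) (zeroˡ _)) (+-identityˡ _) ⟩
    - 1#                                                      ∎
    where open ≡-Reasoning

  Δ-double-root : ∀ x → DoubleRoot Δ x
  Δ-double-root x = Δx≡0 , Δ′x≡0
    where
    open ≡-Reasoning
    Fx F′x : Carrier
    Fx = eval F x
    F′x = eval (deriv F) x
    Fx^q≡Fx : Fx ^ Fq.size ≡ Fx
    Fx^q≡Fx = trans (cong (_^ Fq.size) (sym (proj₂ (values x)))) (trans (ι-^sizeᴱ _) (proj₂ (values x)))
    Δx≡0 : eval Δ x ≡ 0#
    Δx≡0 = begin
      eval Δ x
        ≡⟨ eval-sub (sub (pow F Fq.size) F) (mul W (deriv F)) x ⟩
      eval (sub (pow F Fq.size) F) x - eval (mul W (deriv F)) x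
        ≡⟨ cong₂ _-_ (eval-sub (pow F Fq.size) F x) (eval-mul W (deriv F) x) ⟩
      (eval (pow F Fq.size) x - Fx) - eval W x * F′x
        ≡⟨ cong₂ (λ u v → (u - Fx) - v * F′x) (trans (eval-pow F Fq.size x) Fx^q≡Fx) (eval-W x) ⟩
      (Fx - Fx) - 0# * F′x
        ≡⟨ cong₂ _-_ (-‿inverseʳ Fx) (zeroˡ F′x) ⟩
      0# - 0#
        ≡⟨ -‿inverseʳ 0# ⟩
      0# ∎
    F″x : Carrier
    F″x = eval (deriv (deriv F)) x
    [F^q]′x≡0 : eval (deriv (pow F Fq.size)) x ≡ 0#
    [F^q]′x≡0 = trans (eval-deriv-pow F Fq.size x) (trans (cong (_* (Fx ^ (Fq.size ℕ.∸ 1) * F′x)) sizeᴱ·1≡0) (zeroˡ _))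
    W-term : eval (deriv W) x * F′x + eval W x * F″x ≡ - F′x
    W-term = begin
      eval (deriv W) x * F′x + eval W x * F″x   ≡⟨ cong₂ (λ u v → u * F′x + v * F″x) (eval-deriv-W x) (eval-W x) ⟩
      - 1# * F′x + 0# * F″x                      ≡⟨ cong₂ _+_ (-1*x≈-x F′x) (zeroˡ F″x) ⟩
      - F′x + 0#                                 ≡⟨ +-identityʳ (- F′x) ⟩
      - F′x                                      ∎
    Δ′x≡0 : eval (deriv Δ) x ≡ 0#
    Δ′x≡0 = begin
      eval (deriv Δ) x
        ≡⟨ eval-deriv-sub (sub (pow F Fq.size) F) (mul W (deriv F)) x ⟩
      eval (deriv (sub (pow F Fq.size) F)) x - eval (deriv (mul W (deriv F))) x
        ≡⟨ cong₂ _-_ (eval-deriv-sub (pow F Fq.size) F x) (eval-deriv-mul W (deriv F) x) ⟩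
      (eval (deriv (pow F Fq.size)) x - F′x) - (eval (deriv W) x * F′x + eval W x * F″x)
        ≡⟨ cong₂ (λ u v → (u - F′x) - v) [F^q]′x≡0 W-term ⟩
      (0# - F′x) - - F′x
        ≡⟨ cong (_- - F′x) (+-identityˡ (- F′x)) ⟩
      - F′x - - F′x
        ≡⟨ -‿inverseʳ (- F′x) ⟩
      0# ∎

  mul-W-below : DegreeBelow (mul W (deriv F)) (size ℕ.+ deg F)
  mul-W-below = subst (DegreeBelow (mul W (deriv F))) (trans (sym (ℕ.+-suc size d′)) (cong (size ℕ.+_) (sym deg≡1+d′)))
    (DegreeBelow-mul W (deriv F) size d′ W-below F′-below)
    where
    W-below : DegreeBelow W (suc size)
    W-below = DegreeBelow-sub (monomial size) X (suc size) (DegreeBelow-monomial size)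
      (DegreeBelow-mono X (s≤s (ℕ.≤-trans (s≤s z≤n) 2≤size)) DegreeBelow-X)
    d′ : ℕ
    d′ = ℕ.pred (deg F)
    deg≡1+d′ : deg F ≡ suc d′
    deg≡1+d′ = sym (ℕ.suc-pred (deg F) {{ℕ.>-nonZero 1≤deg}})
    F′-below : DegreeBelow (deriv F) (suc d′)
    F′-below = DegreeBelow-deriv F (suc d′) (subst (λ e → DegreeBelow F (suc e)) deg≡1+d′ (DegreeBelow-deg F))

  Δ-below : DegreeBound → DegreeBelow Δ (size ℕ.+ size)
  Δ-below qd<Q+d =
    DegreeBelow-sub (sub (pow F Fq.size) F) (mul W (deriv F)) (size ℕ.+ size)
      (DegreeBelow-sub (pow F Fq.size) F (size ℕ.+ size)
        (DegreeBelow-mono (pow F Fq.size) (ℕ.≤-trans qd<Q+d d≤Q⇒Q+d≤Q+Q) (DegreeBelow-pow F (deg F) Fq.size (DegreeBelow-deg F)))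
        (DegreeBelow-mono F (ℕ.≤-trans d<Q (ℕ.m≤m+n size size)) (DegreeBelow-deg F)))
      (DegreeBelow-mono (mul W (deriv F)) d≤Q⇒Q+d≤Q+Q mul-W-below)
    where
    d<Q : deg F ℕ.< size
    d<Q = *<+⇒< Fq.size size (deg F) Fq.2≤size qd<Q+d
    d≤Q⇒Q+d≤Q+Q : size ℕ.+ deg F ℕ.≤ size ℕ.+ size
    d≤Q⇒Q+d≤Q+Q = ℕ.+-monoʳ-≤ size (ℕ.<⇒≤ d<Q)

  identity-from-bound : DegreeBound → sub (pow F Fq.size) F ≐ mul W (deriv F)
  identity-from-bound qd<Q+d i =
    x∙y⁻¹≈ε⇒x≈y _ _ (trans (sym (coeff-sub (sub (pow F Fq.size) F) (mul W (deriv F)) i)) (Δ≐0 i))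
    where
    points : List Carrier
    points = map element (allFin size)
    length-points : length points ≡ size
    length-points = trans (List.length-map element (allFin size)) (List.length-tabulate (λ i → i))
    Δ≐0 : Δ ≐ []
    Δ≐0 = double-roots⇒≐[] Δ points (Δ-below qd<Q+d) (ℕ.≤-reflexive (sym (cong₂ ℕ._+_ length-points length-points)))
      (Unique.map⁺ element-injective (Unique.allFin⁺ size)) (All.universal Δ-double-root points)

  bound-from-identity : sub (pow F Fq.size) F ≐ mul W (deriv F) → DegreeBound
  bound-from-identity identity = ℕ.≰⇒> λ Q+d≤qd → ^-≢0 Fq.size (leading-coeff-≢0 F 1≤deg) (leading^q≡0 Q+d≤qd)
    where
    open ≡-Reasoning
    leading^q≡0 : size ℕ.+ deg F ℕ.≤ Fq.size ℕ.* deg F → coeff F (deg F) ^ Fq.size ≡ 0#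
    leading^q≡0 Q+d≤qd = begin
      coeff F (deg F) ^ Fq.size
        ≡⟨ coeff-pow-top F (deg F) Fq.size (DegreeBelow-deg F) ⟨
      coeff (pow F Fq.size) qd
        ≡⟨ +-identityʳ _ ⟨
      coeff (pow F Fq.size) qd + 0#
        ≡⟨ cong (λ u → coeff (pow F Fq.size) qd + u) (trans (cong -_ F-vanishes) -0#≈0#) ⟨
      coeff (pow F Fq.size) qd - coeff F qd
        ≡⟨ coeff-sub (pow F Fq.size) F qd ⟨
      coeff (sub (pow F Fq.size) F) qd
        ≡⟨ identity qd ⟩
      coeff (mul W (deriv F)) qd
        ≡⟨ mul-W-below qd Q+d≤qd ⟩
      0# ∎
      where
      qd : ℕ
      qd = Fq.size ℕ.* deg F
      F-vanishes : coeff F qd ≡ 0#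
      F-vanishes = DegreeBelow-deg F qd (d<q*d Fq.size (deg F) Fq.2≤size 1≤deg)

  mvsp⇔bound : (IsMVSP F × Surjective) ⇔ DegreeBound
  mvsp⇔bound = mk⇔
    (λ (mvsp , surj) → Equivalence.to floor⇔ (trans (sym (valueSetSize≡q surj)) mvsp))
    (λ bound → trans (valueSetSize≡q (surjective bound)) (Equivalence.from floor⇔ bound) , surjective bound)
    where
    floor⇔ : (Fq.size ≡ suc (floorDiv (size ℕ.∸ 1) (deg F))) ⇔ DegreeBound
    floor⇔ = q≡1+floorDiv⇔q*d<Q+d Fq.size size (deg F) (ℕ.≤-trans (s≤s z≤n) Fq.2≤size)
               (ℕ.≤-trans (s≤s z≤n) 2≤size) 1≤deg size≤q*deg

  identity⇔bound : (sub (pow F Fq.size) F ≐ mul W (deriv F)) ⇔ DegreeBound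
  identity⇔bound = mk⇔ bound-from-identity identity-from-bound

open import Data.Nat using (_^_; _≤_; _<_; _∸_; _*_)

⇔-×-fact : ∀ {A B P : Set} → P → A ⇔ B → A ⇔ (P × B)
⇔-×-fact p A⇔B = mk⇔ (λ a → p , Equivalence.to A⇔B a) (Equivalence.from A⇔B ∘ proj₂)

lemma4p1 : (q n : ℕ) → IsPrimePower q → 1 ≤ n
    → (Fq K : FiniteField) → FiniteField.size Fq ≡ q → FiniteField.size K ≡ q ^ n
    → (ι : FiniteField.Carrier Fq → FiniteField.Carrier K) → IsFieldEmbedding Fq K ι
    → (F : Poly.Pol K) → 1 ≤ Poly.deg K F
    → (∀ a → ∃[ c ] (ι c ≡ Poly.eval K F a))
    → let open Poly K
          C1 = IsMVSP F × (∀ b → ∃[ a ] (eval F a ≡ ι b))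
          C2 = sub (pow F q) F ≐ mul (sub (monomial (q ^ n)) X) (deriv F)
          C3 = q ^ (n ∸ 1) ≤ deg F × deg F ≤ floorDiv (q ^ n ∸ 1) (q ∸ 1)
          C4 = 0 < deg F × deg F ≤ floorDiv (q ^ n ∸ 1) (q ∸ 1)
      in (C1 ⇔ C2) × (C1 ⇔ C3) × (C1 ⇔ C4)
-- That q is a prime power follows from Fq being a field.
lemma4p1 .(FiniteField.size Fq) n _ 1≤n Fq K refl Q≡q^n ι emb F 1≤deg values rewrite sym Q≡q^n =
    ⇔-trans mvsp⇔bound (⇔-sym identity⇔bound)
  , ⇔-×-fact lower-bound (⇔-trans mvsp⇔bound (⇔-sym floor⇔))
  , ⇔-×-fact 1≤deg (⇔-trans mvsp⇔bound (⇔-sym floor⇔))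
  where
  open ValueSet Fq K ι emb F 1≤deg values
  open NatLemmas
  q : ℕ
  q = FiniteField.size Fq
  floor⇔ : (Poly.deg K F ≤ floorDiv (FiniteField.size K ∸ 1) (q ∸ 1)) ⇔ DegreeBound
  floor⇔ = d≤floorDiv⇔q*d<Q+d q (FiniteField.size K) (Poly.deg K F) (FiniteFieldLemmas.2≤size Fq)
             (ℕ.≤-trans (s≤s z≤n) (FiniteFieldLemmas.2≤size K))
  lower-bound : q ^ (n ∸ 1) ≤ Poly.deg K F
  lower-bound = q^n≤q*d⇒q^[n∸1]≤d q n (Poly.deg K F) (ℕ.≤-trans (s≤s z≤n) (FiniteFieldLemmas.2≤size Fq)) 1≤n
                  (subst (_≤ q * Poly.deg K F) Q≡q^n size≤q*deg)
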